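{- In the timed process algebra T-AWN (default version, in which all nodes are input enabled), every complete network expression $N$ admits a transition independently of the outside environment: there exists an action $a$ with $N\xrightarrow{a}$ and $a$ not of the form $\mathbf{connect}(ip,ip')$, $\mathbf{disconnect}(ip,ip')$ or $ip{:}\mathbf{newpkt}(d,dip)$. More precisely, either $N\xrightarrow{\mathrm{tick}}$, or $N\xrightarrow{ip:\mathbf{deliver}(d)}$ for some $ip,d$, or $N\xrightarrow{\tau}$.
   Context: $X\xrightarrow{a}$ means that some transition labelled $a$ leaves $X$. The auxiliary construct $\mathbf{*cast}$ never occurs inside a $+$-context. SEQUENTIAL LEVEL. Valuations $\xi$ are partial maps from variables to data values (types include TIME, DATA, MSG, IP, $\mathcal{P}(\mathrm{IP})$); $\xi(e)\!\downarrow$ means $e$ is defined under $\xi$. $\mathtt{now}$ is a TIME variable and $\xi[\mathtt{now}{+}{+}]$ increments it by 1. Process names have guarded defining equations $X(\vec{\mathtt{var}})\stackrel{def}{=}p$: every call in $p$ occurs inside $[\varphi]q$, $[\![\mathtt{var}:=e]\!]q$, $\alpha.q$ or $\mathbf{unicast}(dest,ms).q\blacktriangleright r$. Sequential expressions: $SP::=X(\vec e)\mid[\varphi]SP\mid[\![\mathtt{var}:=e]\!]SP\mid SP+SP\mid\alpha.SP\mid\mathbf{unicast}(dest,ms).SP\blacktriangleright SP\mid\mathbf{*cast}_{dsts}(m)[n,o].SP\blacktriangleright SP$, with $\alpha::=\mathbf{broadcast}(ms)\mid\mathbf{groupcast}(dests,ms)\mid\mathbf{send}(ms)\mid\mathbf{deliver}(data)\mid\mathbf{receive}(\mathtt{msg})$.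 Constants $LB,LG,LU>0$ and $\Delta B,\Delta G,\Delta U\ge0$ are fixed. Process actions: $\tau$, $R{:}\mathbf{*cast}(m)$, $\mathbf{send}(m)$, $\mathbf{deliver}(d)$, $\mathbf{receive}(m)$, wait actions $w_1\in\mathcal{W}=\{\mathrm{w},\mathrm{wr},\mathrm{ws},\mathrm{wrs}\}$, and $R{:}w_1$. Join $\wedge$ on $\mathcal{W}$: $\mathrm{w}$ is neutral, idempotent, $\mathrm{wr}\wedge\mathrm{ws}=\mathrm{wrs}$, and $\mathrm{wrs}$ is absorbing. Sequential rules: - broadcast/groupcast/unicast with defined arguments $\xrightarrow{\tau}$ $\mathbf{*cast}_{\mathrm{IP}}(\xi(ms))[LB,\Delta B].p\blacktriangleright p$ / $\mathbf{*cast}_{\xi(dests)}(\xi(ms))[LG,\Delta G].p\blacktriangleright p$ / $\mathbf{*cast}_{\{\xi(dest)\}}(\xi(ms))[LU,\Delta U].p\blacktriangleright q$. - For all $R$: $\xi,\mathbf{*cast}_{dsts}(m)[n{+}1,o].p\blacktriangleright q\xrightarrow{R:\mathrm{w}}\xi[\mathtt{now}{+}{+}],\mathbf{*cast}_{dsts\cap R}(m)[n,o].p\blacktriangleright q$, and from $[n{+}1,o{+}1]$ to $[n{+}1,o]$ likewise. - $\mathbf{*cast}_{dsts}(m)[0,o].p\blacktriangleright q\xrightarrow{dsts:\mathbf{*cast}(m)}p$ if $dsts\ne\emptyset$, else $\to q$. - $\mathbf{send}(ms).p$ (with $\xi(ms)$ defined) has $\xrightarrow{\mathbf{send}(\xi(ms))}\xi,p$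 and $\xrightarrow{\mathrm{ws}}\xi[\mathtt{now}{+}{+}],\mathbf{send}(ms).p$. - $\mathbf{deliver}(data).p\xrightarrow{\mathbf{deliver}(\xi(data))}p$. - $\mathbf{receive}(\mathtt{msg}).p$ has $\xrightarrow{\mathbf{receive}(m)}\xi[\mathtt{msg}:=m],p$ for all $m$, and $\xrightarrow{\mathrm{wr}}$ to itself with $\xi[\mathtt{now}{+}{+}]$. - $[\![\mathtt{var}:=e]\!]p\xrightarrow{\tau}\xi[\mathtt{var}:=\xi(e)],p$. - A state whose leading broadcast/groupcast/unicast/send/deliver/assignment/call has an undefined argument does $\xrightarrow{\mathrm{w}}$ to itself with $\xi[\mathtt{now}{+}{+}]$. - A call $X(\vec e)$ with defined arguments inherits the non-wait transitions of $\emptyset[\mathtt{var}_i:=\xi(e_i)],p$, and for each wait action $w_1$ of it does $\xrightarrow{w_1}\xi[\mathtt{now}{+}{+}],X(\vec e)$. - $[\varphi]p\xrightarrow{\tau}\zeta,p$ for each extension $\zeta$ of $\xi$ to the free variables of $\varphi$ satisfying $\varphi$; otherwise $\xrightarrow{\mathrm{w}}\xi[\mathtt{now}{+}{+}],[\varphi]p$. - $p+q$ inherits the non-wait transitions of both summands and does $w_1\wedge w_2$ to $\xi[\mathtt{now}{+}{+}],p'+q'$ when $p\xrightarrow{w_1}p'$ and $q\xrightarrow{w_2}q'$. PARALLEL LEVEL: $PP::=\xi,SP\mid PP\langle\!\langle PP$. Partial function $\langle\!\langle$ on $\mathcal{W}$: $\mathrm{w}\langle\!\langle(\mathrm{w},\mathrm{wr},\mathrm{ws},\mathrm{wrs})=(\mathrm{w},\mathrm{wr},\mathrm{w},\mathrm{wr})$;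 $\mathrm{wr}\langle\!\langle(\mathrm{w},\mathrm{wr})=(\mathrm{w},\mathrm{wr})$; $\mathrm{ws}\langle\!\langle(\mathrm{w},\mathrm{wr},\mathrm{ws},\mathrm{wrs})=(\mathrm{ws},\mathrm{wrs},\mathrm{ws},\mathrm{wrs})$; $\mathrm{wrs}\langle\!\langle(\mathrm{w},\mathrm{wr})=(\mathrm{ws},\mathrm{wrs})$; otherwise undefined. Parallel rules: - $P\xrightarrow{a}P'$ gives $P\langle\!\langle Q\xrightarrow{a}P'\langle\!\langle Q$ for $a$ not a receive action, not in $\mathcal{W}$ and not of the form $R{:}w_1$. - $Q\xrightarrow{a}Q'$ gives $P\langle\!\langle Q\xrightarrow{a}P\langle\!\langle Q'$ for $a$ not a send action, not in $\mathcal{W}$ and not of the form $R{:}w_1$. - $\mathbf{receive}(m)$ of $P$ with $\mathbf{send}(m)$ of $Q$ yields $\tau$. - Time steps $x$ of $P$ and $y$ of $Q$ (each $w_i$ or $R{:}w_i$, the same $R$ if both are transmission actions), with $w_3=w_1\langle\!\langle w_2$ defined, combine to $w_3$ if both are plain wait actions and to $R{:}w_3$ otherwise. NODES: $ip:P:R$. Rules: - $P\xrightarrow{dsts:\mathbf{*cast}(m)}P'$ gives the same label on the node; - $P\xrightarrow{\mathbf{receive}(m)}P'$ gives $\xrightarrow{\{ip\}\neg\emptyset:\mathbf{arrive}(m)}$; - $P\xrightarrow{\mathbf{deliver}(d)}P'$ gives $\xrightarrow{ip:\mathbf{deliver}(d)}$; - always $ip:P:R\xrightarrow{\emptyset\neg\{ip\}:\mathbf{arrive}(m)}ip:P:R$;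 - $\tau$ passes through; - $P\xrightarrow{w_1}P'$ or $P\xrightarrow{R:w_1}P'$ with $R$ the node's own range give $\xrightarrow{\mathrm{tick}}$; - $\mathbf{connect}(ip,ip')$ / $\mathbf{disconnect}(ip,ip')$ modify $R$. NETWORKS: $M::=ip:P:R\mid M\|M$, complete networks $[M]$. Rules: - a $R{:}\mathbf{*cast}(m)$ of one component synchronises with $H\neg K:\mathbf{arrive}(m)$ of the other ($H\subseteq R$, $K\cap R=\emptyset$), yielding $R{:}\mathbf{*cast}(m)$; - arrive actions of both components combine by unions; - tick requires tick of both components; - $ip{:}\mathbf{deliver}(d)$, $\tau$ and (dis)connect actions interleave in $\|$ and pass through $[\cdot]$; - $[\cdot]$ passes tick, turns $R{:}\mathbf{*cast}(m)$ into $\tau$, turns $\{ip\}\neg K:\mathbf{arrive}(\mathbf{newpkt}(d,dip))$ into $ip{:}\mathbf{newpkt}(d,dip)$, and blocks all other arrive actions. Standing assumption (input enabledness, default version): for every node expression $ip:P:R$ and every $m\in\mathrm{MSG}$, $P\xrightarrow{\mathbf{receive}(m)}$. -}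

module Defs where

open import Level using (0ℓ; Lift)
open import Data.Nat using (ℕ; zero; suc; _<_)
open import Data.Maybe using (Maybe; just; nothing; map; _>>=_)
open import Data.List using (List)
open import Data.List.Membership.Propositional using () renaming (_∈_ to _∈ᴸ_)
open import Data.Vec using (Vec; []; _∷_)
open import Data.Product using (Σ; ∃; _×_; _,_)
open import Data.Empty using (⊥)
open import Data.Unit using (⊤)
open import Relation.Nullary using (¬_)
open import Relation.Binary.PropositionalEquality using (_≡_; _≢_)
open import Relation.Binary.Definitions using (DecidableEquality)
open import Relation.Unary using (Pred; _∩_; _∪_; _⊆_; _≐_; U; ∅; ｛_｝; Satisfiable; Empty; _∈_; _∉_; _∖_)
open import Relation.Nullary.Decidable using (yes; no)

record Signature : Set₁ where
  field
    IP MSG DATA : Set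
    -- data values (of all types) and variables
    Val Var : Set
    _≟ᵛ_ : DecidableEquality Var
    now : Var
    -- TIME values inside the universe of data values
    fromTime : ℕ → Val
    toTime   : Val → Maybe ℕ
    -- MSG values inside the universe of data values (for receive(msg))
    fromMsg  : MSG → Val
    newpkt : DATA → IP → MSG
    -- expressions of the various types, with partial evaluation under a
    -- (partial) valuation; 'nothing' means "undefined"
    Exp IPExp IPSetExp MSGExp DATAExp : Set
    evalE     : Exp → (Var → Maybe Val) → Maybe Val
    evalIP    : IPExp → (Var → Maybe Val) → Maybe IP
    evalIPSet : IPSetExp → (Var → Maybe Val) → Maybe (Pred IP 0ℓ)
    evalMSG   : MSGExp → (Var → Maybe Val) → Maybe MSG
    evalDATA  : DATAExp → (Var → Maybe Val) → Maybe DATA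
    Cond : Set
    fv   : Cond → List Var
    _⊨_  : (Var → Maybe Val) → Cond → Set
    PName : Set
    arity : PName → ℕ
    LB LG LU ΔB ΔG ΔU : ℕ
    LB>0 : 0 < LB
    LG>0 : 0 < LG
    LU>0 : 0 < LU

module Semantics (S : Signature) where
  open Signature S public

  Valuation : Set
  Valuation = Var → Maybe Val

  IPSet : Set₁
  IPSet = Pred IP 0ℓ

  _[_≔_] : Valuation → Var → Val → Valuation
  (ξ [ x ≔ v ]) y with x ≟ᵛ y
  ... | yes _ = just v
  ... | no  _ = ξ y

  _[now++] : Valuation → Valuation
  (ξ [now++]) y with now ≟ᵛ y
  ... | yes _ = map (λ t → fromTime (suc t)) (ξ now >>= toTime)
  ... | no  _ = ξ y

  ∅ᵛ : Valuation
  ∅ᵛ _ = nothing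

  evalArgs : ∀ {n} → Vec Exp n → Valuation → Maybe (Vec Val n)
  evalArgs [] ξ = just []
  evalArgs (e ∷ es) ξ = evalE e ξ >>= λ v → map (v ∷_) (evalArgs es ξ)

  bind : ∀ {n} → Vec Var n → Vec Val n → Valuation
  bind [] [] = ∅ᵛ
  bind (x ∷ xs) (v ∷ vs) = bind xs vs [ x ≔ v ]

  Extends : Valuation → Cond → Valuation → Set
  Extends ξ φ ζ =
      (∀ x → ¬ (x ∈ᴸ fv φ) → ζ x ≡ ξ x)
    × (∀ x → x ∈ᴸ fv φ → ξ x ≢ nothing → ζ x ≡ ξ x)
    × (∀ x → x ∈ᴸ fv φ → ζ x ≢ nothing)

  data SP : Set₁ where
    call      : (X : PName) → Vec Exp (arity X) → SP
    guard     : Cond → SP → SP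
    assign    : Var → Exp → SP → SP
    _⊕_       : SP → SP → SP
    broadcast : MSGExp → SP → SP
    groupcast : IPSetExp → MSGExp → SP → SP
    unicast   : IPExp → MSGExp → SP → SP → SP
    send      : MSGExp → SP → SP
    deliver   : DATAExp → SP → SP
    receive   : Var → SP → SP
    *cast     : IPSet → MSG → (n o : ℕ) → SP → SP → SP

  record Spec : Set₁ where
    field
      params : (X : PName) → Vec Var (arity X)
      body   : PName → SP

  -- every call of a process name occurs inside a guard, an assignment,
  -- an action prefix α.q or a unicast (we also count *cast as a prefix)
  Guarded : SP → Set
  Guarded (call X es)         = ⊥
  Guarded (p ⊕ q)             = Guarded p × Guarded q
  Guarded (guard φ p)         = ⊤
  Guarded (assign x e p)      = ⊤
  Guarded (broadcast m p)     = ⊤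
  Guarded (groupcast d m p)   = ⊤
  Guarded (unicast d m p q)   = ⊤
  Guarded (send m p)          = ⊤
  Guarded (deliver d p)       = ⊤
  Guarded (receive x p)       = ⊤
  Guarded (*cast d m n o p q) = ⊤

  CastFree : SP → Set
  CastFree (call X es)         = ⊤
  CastFree (guard φ p)         = CastFree p
  CastFree (assign x e p)      = CastFree p
  CastFree (p ⊕ q)             = CastFree p × CastFree q
  CastFree (broadcast m p)     = CastFree p
  CastFree (groupcast d m p)   = CastFree p
  CastFree (unicast d m p q)   = CastFree p × CastFree q
  CastFree (send m p)          = CastFree p
  CastFree (deliver d p)       = CastFree p
  CastFree (receive x p)       = CastFree p
  CastFree (*cast d m n o p q) = ⊥

  NoCastInSum : SP → Set
  NoCastInSum (call X es)         = ⊤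
  NoCastInSum (guard φ p)         = NoCastInSum p
  NoCastInSum (assign x e p)      = NoCastInSum p
  NoCastInSum (p ⊕ q)             = CastFree p × CastFree q
  NoCastInSum (broadcast m p)     = NoCastInSum p
  NoCastInSum (groupcast d m p)   = NoCastInSum p
  NoCastInSum (unicast d m p q)   = NoCastInSum p × NoCastInSum q
  NoCastInSum (send m p)          = NoCastInSum p
  NoCastInSum (deliver d p)       = NoCastInSum p
  NoCastInSum (receive x p)       = NoCastInSum p
  NoCastInSum (*cast d m n o p q) = NoCastInSum p × NoCastInSum q

  WellFormedSpec : Spec → Set
  WellFormedSpec Δ = ∀ X → Guarded (Spec.body Δ X) × NoCastInSum (Spec.body Δ X)

  data W : Set where
    w wr ws wrs : W

  _∧ʷ_ : W → W → W
  w   ∧ʷ y   = y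
  wr  ∧ʷ w   = wr
  wr  ∧ʷ wr  = wr
  wr  ∧ʷ ws  = wrs
  wr  ∧ʷ wrs = wrs
  ws  ∧ʷ w   = ws
  ws  ∧ʷ wr  = wrs
  ws  ∧ʷ ws  = ws
  ws  ∧ʷ wrs = wrs
  wrs ∧ʷ y   = wrs

  _⟪ʷ_ : W → W → Maybe W
  w   ⟪ʷ w   = just w
  w   ⟪ʷ wr  = just wr
  w   ⟪ʷ ws  = just w
  w   ⟪ʷ wrs = just wr
  wr  ⟪ʷ w   = just w
  wr  ⟪ʷ wr  = just wr
  wr  ⟪ʷ ws  = nothing
  wr  ⟪ʷ wrs = nothing
  ws  ⟪ʷ w   = just ws
  ws  ⟪ʷ wr  = just wrs
  ws  ⟪ʷ ws  = just ws
  ws  ⟪ʷ wrs = just wrs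
  wrs ⟪ʷ w   = just ws
  wrs ⟪ʷ wr  = just wrs
  wrs ⟪ʷ ws  = nothing
  wrs ⟪ʷ wrs = nothing

  data Act : Set₁ where
    τ       : Act
    cast    : IPSet → MSG → Act
    sendA   : MSG → Act
    deliverA : DATA → Act
    receiveA : MSG → Act
    wait    : W → Act
    rwait   : IPSet → W → Act

  data NonWait : Act → Set₁ where
    τ        : NonWait τ
    cast     : ∀ R m → NonWait (cast R m)
    sendA    : ∀ m → NonWait (sendA m)
    deliverA : ∀ d → NonWait (deliverA d)
    receiveA : ∀ m → NonWait (receiveA m)
    rwait    : ∀ R w₁ → NonWait (rwait R w₁)

  data LeftPass : Act → Set₁ where
    τ        : LeftPass τ
    cast     : ∀ R m → LeftPass (cast R m)
    sendA    : ∀ m → LeftPass (sendA m)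
    deliverA : ∀ d → LeftPass (deliverA d)

  data RightPass : Act → Set₁ where
    τ        : RightPass τ
    cast     : ∀ R m → RightPass (cast R m)
    deliverA : ∀ d → RightPass (deliverA d)
    receiveA : ∀ m → RightPass (receiveA m)

  data _⊢_,_─[_]→_,_ (Δ : Spec) : Valuation → SP → Act → Valuation → SP → Set₁ where
    bc  : ∀ {ξ ms p m} → evalMSG ms ξ ≡ just m →
          Δ ⊢ ξ , broadcast ms p ─[ τ ]→ ξ , *cast U m LB ΔB p p
    gc  : ∀ {ξ ds ms p D m} → evalIPSet ds ξ ≡ just D → evalMSG ms ξ ≡ just m →
          Δ ⊢ ξ , groupcast ds ms p ─[ τ ]→ ξ , *cast D m LG ΔG p p
    uc  : ∀ {ξ d ms p q i m} → evalIP d ξ ≡ just i → evalMSG ms ξ ≡ just m →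
          Δ ⊢ ξ , unicast d ms p q ─[ τ ]→ ξ , *cast ｛ i ｝ m LU ΔU p q
    cw₁ : ∀ {ξ D m n o p q} (R : IPSet) →
          Δ ⊢ ξ , *cast D m (suc n) o p q ─[ rwait R w ]→ ξ [now++] , *cast (D ∩ R) m n o p q
    cw₂ : ∀ {ξ D m n o p q} (R : IPSet) →
          Δ ⊢ ξ , *cast D m (suc n) (suc o) p q ─[ rwait R w ]→ ξ [now++] , *cast (D ∩ R) m (suc n) o p q
    cok : ∀ {ξ D m o p q} → Satisfiable D →
          Δ ⊢ ξ , *cast D m 0 o p q ─[ cast D m ]→ ξ , p
    cno : ∀ {ξ D m o p q} → Empty D →
          Δ ⊢ ξ , *cast D m 0 o p q ─[ τ ]→ ξ , q
    snd  : ∀ {ξ ms p m} → evalMSG ms ξ ≡ just m →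
           Δ ⊢ ξ , send ms p ─[ sendA m ]→ ξ , p
    sndw : ∀ {ξ ms p m} → evalMSG ms ξ ≡ just m →
           Δ ⊢ ξ , send ms p ─[ wait ws ]→ ξ [now++] , send ms p
    dlv  : ∀ {ξ e p d} → evalDATA e ξ ≡ just d →
           Δ ⊢ ξ , deliver e p ─[ deliverA d ]→ ξ , p
    rcv  : ∀ {ξ x p} (m : MSG) →
           Δ ⊢ ξ , receive x p ─[ receiveA m ]→ ξ [ x ≔ fromMsg m ] , p
    rcvw : ∀ {ξ x p} →
           Δ ⊢ ξ , receive x p ─[ wait wr ]→ ξ [now++] , receive x p
    asg  : ∀ {ξ x e p v} → evalE e ξ ≡ just v →
           Δ ⊢ ξ , assign x e p ─[ τ ]→ ξ [ x ≔ v ] , p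
    bcU  : ∀ {ξ ms p} → evalMSG ms ξ ≡ nothing →
           Δ ⊢ ξ , broadcast ms p ─[ wait w ]→ ξ [now++] , broadcast ms p
    gcU₁ : ∀ {ξ ds ms p} → evalIPSet ds ξ ≡ nothing →
           Δ ⊢ ξ , groupcast ds ms p ─[ wait w ]→ ξ [now++] , groupcast ds ms p
    gcU₂ : ∀ {ξ ds ms p} → evalMSG ms ξ ≡ nothing →
           Δ ⊢ ξ , groupcast ds ms p ─[ wait w ]→ ξ [now++] , groupcast ds ms p
    ucU₁ : ∀ {ξ d ms p q} → evalIP d ξ ≡ nothing →
           Δ ⊢ ξ , unicast d ms p q ─[ wait w ]→ ξ [now++] , unicast d ms p q
    ucU₂ : ∀ {ξ d ms p q} → evalMSG ms ξ ≡ nothing →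
           Δ ⊢ ξ , unicast d ms p q ─[ wait w ]→ ξ [now++] , unicast d ms p q
    sndU : ∀ {ξ ms p} → evalMSG ms ξ ≡ nothing →
           Δ ⊢ ξ , send ms p ─[ wait w ]→ ξ [now++] , send ms p
    dlvU : ∀ {ξ e p} → evalDATA e ξ ≡ nothing →
           Δ ⊢ ξ , deliver e p ─[ wait w ]→ ξ [now++] , deliver e p
    asgU : ∀ {ξ x e p} → evalE e ξ ≡ nothing →
           Δ ⊢ ξ , assign x e p ─[ wait w ]→ ξ [now++] , assign x e p
    callU : ∀ {ξ X es} → evalArgs es ξ ≡ nothing →
           Δ ⊢ ξ , call X es ─[ wait w ]→ ξ [now++] , call X es
    callA : ∀ {ξ X es vs a ζ p'} → evalArgs es ξ ≡ just vs → NonWait a →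
            Δ ⊢ bind (Spec.params Δ X) vs , Spec.body Δ X ─[ a ]→ ζ , p' →
            Δ ⊢ ξ , call X es ─[ a ]→ ζ , p'
    callW : ∀ {ξ X es vs w₁ ζ p'} → evalArgs es ξ ≡ just vs →
            Δ ⊢ bind (Spec.params Δ X) vs , Spec.body Δ X ─[ wait w₁ ]→ ζ , p' →
            Δ ⊢ ξ , call X es ─[ wait w₁ ]→ ξ [now++] , call X es
    grd  : ∀ {ξ φ p} (ζ : Valuation) → Extends ξ φ ζ → ζ ⊨ φ →
           Δ ⊢ ξ , guard φ p ─[ τ ]→ ζ , p
    grdW : ∀ {ξ φ p} → ¬ (∃ λ ζ → Extends ξ φ ζ × ζ ⊨ φ) →
           Δ ⊢ ξ , guard φ p ─[ wait w ]→ ξ [now++] , guard φ p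
    sumL : ∀ {ξ p q a ζ p'} → NonWait a → Δ ⊢ ξ , p ─[ a ]→ ζ , p' →
           Δ ⊢ ξ , (p ⊕ q) ─[ a ]→ ζ , p'
    sumR : ∀ {ξ p q a ζ q'} → NonWait a → Δ ⊢ ξ , q ─[ a ]→ ζ , q' →
           Δ ⊢ ξ , (p ⊕ q) ─[ a ]→ ζ , q'
    sumW : ∀ {ξ p q w₁ w₂ ζ₁ ζ₂ p' q'} →
           Δ ⊢ ξ , p ─[ wait w₁ ]→ ζ₁ , p' → Δ ⊢ ξ , q ─[ wait w₂ ]→ ζ₂ , q' →
           Δ ⊢ ξ , (p ⊕ q) ─[ wait (w₁ ∧ʷ w₂) ]→ ξ [now++] , (p' ⊕ q')

  data PP : Set₁ where
    ⟨_,_⟩ : Valuation → SP → PP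
    _⟪_  : PP → PP → PP

  data _⊢_─[_]→ᴾ_ (Δ : Spec) : PP → Act → PP → Set₁ where
    seq   : ∀ {ξ p a ζ q} → Δ ⊢ ξ , p ─[ a ]→ ζ , q → Δ ⊢ ⟨ ξ , p ⟩ ─[ a ]→ᴾ ⟨ ζ , q ⟩
    left  : ∀ {P P' Q a} → LeftPass a → Δ ⊢ P ─[ a ]→ᴾ P' → Δ ⊢ (P ⟪ Q) ─[ a ]→ᴾ (P' ⟪ Q)
    right : ∀ {P Q Q' a} → RightPass a → Δ ⊢ Q ─[ a ]→ᴾ Q' → Δ ⊢ (P ⟪ Q) ─[ a ]→ᴾ (P ⟪ Q')
    comm  : ∀ {P P' Q Q' m} → Δ ⊢ P ─[ receiveA m ]→ᴾ P' → Δ ⊢ Q ─[ sendA m ]→ᴾ Q' →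
            Δ ⊢ (P ⟪ Q) ─[ τ ]→ᴾ (P' ⟪ Q')
    tWW   : ∀ {P P' Q Q' w₁ w₂ w₃} → Δ ⊢ P ─[ wait w₁ ]→ᴾ P' → Δ ⊢ Q ─[ wait w₂ ]→ᴾ Q' →
            w₁ ⟪ʷ w₂ ≡ just w₃ → Δ ⊢ (P ⟪ Q) ─[ wait w₃ ]→ᴾ (P' ⟪ Q')
    tRW   : ∀ {P P' Q Q' R w₁ w₂ w₃} → Δ ⊢ P ─[ rwait R w₁ ]→ᴾ P' → Δ ⊢ Q ─[ wait w₂ ]→ᴾ Q' →
            w₁ ⟪ʷ w₂ ≡ just w₃ → Δ ⊢ (P ⟪ Q) ─[ rwait R w₃ ]→ᴾ (P' ⟪ Q')
    tWR   : ∀ {P P' Q Q' R w₁ w₂ w₃} → Δ ⊢ P ─[ wait w₁ ]→ᴾ P' → Δ ⊢ Q ─[ rwait R w₂ ]→ᴾ Q' →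
            w₁ ⟪ʷ w₂ ≡ just w₃ → Δ ⊢ (P ⟪ Q) ─[ rwait R w₃ ]→ᴾ (P' ⟪ Q')
    tRR   : ∀ {P P' Q Q' R w₁ w₂ w₃} → Δ ⊢ P ─[ rwait R w₁ ]→ᴾ P' → Δ ⊢ Q ─[ rwait R w₂ ]→ᴾ Q' →
            w₁ ⟪ʷ w₂ ≡ just w₃ → Δ ⊢ (P ⟪ Q) ─[ rwait R w₃ ]→ᴾ (P' ⟪ Q')

  AllSeq : (SP → Set) → PP → Set
  AllSeq Q ⟨ ξ , p ⟩ = Q p
  AllSeq Q (P ⟪ P') = AllSeq Q P × AllSeq Q P'

  data NAct : Set₁ where
    cast       : IPSet → MSG → NAct
    arrive     : IPSet → IPSet → MSG → NAct    -- H¬K:arrive(m)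
    deliverN   : IP → DATA → NAct
    τ          : NAct
    tick       : NAct
    connect    : IP → IP → NAct
    disconnect : IP → IP → NAct
    newpktN    : IP → DATA → IP → NAct

  data Node : Set₁ where
    _∶_∶_ : IP → PP → IPSet → Node

  data _⊢_─[_]→ᴺ_ (Δ : Spec) : Node → NAct → Node → Set₁ where
    ncast  : ∀ {i P P' R D m} → Δ ⊢ P ─[ cast D m ]→ᴾ P' →
             Δ ⊢ (i ∶ P ∶ R) ─[ cast D m ]→ᴺ (i ∶ P' ∶ R)
    nrecv  : ∀ {i P P' R m} → Δ ⊢ P ─[ receiveA m ]→ᴾ P' →
             Δ ⊢ (i ∶ P ∶ R) ─[ arrive ｛ i ｝ ∅ m ]→ᴺ (i ∶ P' ∶ R)
    ndlv   : ∀ {i P P' R d} → Δ ⊢ P ─[ deliverA d ]→ᴾ P' →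
             Δ ⊢ (i ∶ P ∶ R) ─[ deliverN i d ]→ᴺ (i ∶ P' ∶ R)
    nnot   : ∀ {i P R} (m : MSG) →
             Δ ⊢ (i ∶ P ∶ R) ─[ arrive ∅ ｛ i ｝ m ]→ᴺ (i ∶ P ∶ R)
    nτ     : ∀ {i P P' R} → Δ ⊢ P ─[ τ ]→ᴾ P' →
             Δ ⊢ (i ∶ P ∶ R) ─[ τ ]→ᴺ (i ∶ P' ∶ R)
    ntickW : ∀ {i P P' R w₁} → Δ ⊢ P ─[ wait w₁ ]→ᴾ P' →
             Δ ⊢ (i ∶ P ∶ R) ─[ tick ]→ᴺ (i ∶ P' ∶ R)
    ntickR : ∀ {i P P' R w₁} → Δ ⊢ P ─[ rwait R w₁ ]→ᴾ P' →
             Δ ⊢ (i ∶ P ∶ R) ─[ tick ]→ᴺ (i ∶ P' ∶ R)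
    ncon₁  : ∀ {i P R} (i' : IP) →
             Δ ⊢ (i ∶ P ∶ R) ─[ connect i i' ]→ᴺ (i ∶ P ∶ (R ∪ ｛ i' ｝))
    ncon₂  : ∀ {i P R} (i' : IP) →
             Δ ⊢ (i ∶ P ∶ R) ─[ connect i' i ]→ᴺ (i ∶ P ∶ (R ∪ ｛ i' ｝))
    ndis₁  : ∀ {i P R} (i' : IP) →
             Δ ⊢ (i ∶ P ∶ R) ─[ disconnect i i' ]→ᴺ (i ∶ P ∶ (R ∖ ｛ i' ｝))
    ndis₂  : ∀ {i P R} (i' : IP) →
             Δ ⊢ (i ∶ P ∶ R) ─[ disconnect i' i ]→ᴺ (i ∶ P ∶ (R ∖ ｛ i' ｝))

  data Net : Set₁ where
    node : Node → Net
    _∥_  : Net → Net → Net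

  data Interleave : NAct → Set₁ where
    deliverN   : ∀ i d → Interleave (deliverN i d)
    τ          : Interleave τ
    connect    : ∀ i i' → Interleave (connect i i')
    disconnect : ∀ i i' → Interleave (disconnect i i')

  data _⊢_─[_]→ᴹ_ (Δ : Spec) : Net → NAct → Net → Set₁ where
    mnode  : ∀ {n n' a} → Δ ⊢ n ─[ a ]→ᴺ n' → Δ ⊢ node n ─[ a ]→ᴹ node n'
    castL  : ∀ {M M' N N' R H K m} → Δ ⊢ M ─[ cast R m ]→ᴹ M' → Δ ⊢ N ─[ arrive H K m ]→ᴹ N' →
             H ⊆ R → Empty (K ∩ R) → Δ ⊢ (M ∥ N) ─[ cast R m ]→ᴹ (M' ∥ N')
    castR  : ∀ {M M' N N' R H K m} → Δ ⊢ M ─[ arrive H K m ]→ᴹ M' → Δ ⊢ N ─[ cast R m ]→ᴹ N' →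
             H ⊆ R → Empty (K ∩ R) → Δ ⊢ (M ∥ N) ─[ cast R m ]→ᴹ (M' ∥ N')
    arr    : ∀ {M M' N N' H K H' K' m} → Δ ⊢ M ─[ arrive H K m ]→ᴹ M' → Δ ⊢ N ─[ arrive H' K' m ]→ᴹ N' →
             Δ ⊢ (M ∥ N) ─[ arrive (H ∪ H') (K ∪ K') m ]→ᴹ (M' ∥ N')
    tck    : ∀ {M M' N N'} → Δ ⊢ M ─[ tick ]→ᴹ M' → Δ ⊢ N ─[ tick ]→ᴹ N' →
             Δ ⊢ (M ∥ N) ─[ tick ]→ᴹ (M' ∥ N')
    intL   : ∀ {M M' N a} → Interleave a → Δ ⊢ M ─[ a ]→ᴹ M' → Δ ⊢ (M ∥ N) ─[ a ]→ᴹ (M' ∥ N)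
    intR   : ∀ {M N N' a} → Interleave a → Δ ⊢ N ─[ a ]→ᴹ N' → Δ ⊢ (M ∥ N) ─[ a ]→ᴹ (M ∥ N')

  data CNet : Set₁ where
    [_] : Net → CNet

  data _⊢_─[_]→ᶜ_ (Δ : Spec) : CNet → NAct → CNet → Set₁ where
    ctick : ∀ {M M'} → Δ ⊢ M ─[ tick ]→ᴹ M' → Δ ⊢ [ M ] ─[ tick ]→ᶜ [ M' ]
    ccast : ∀ {M M' R m} → Δ ⊢ M ─[ cast R m ]→ᴹ M' → Δ ⊢ [ M ] ─[ τ ]→ᶜ [ M' ]
    cnew  : ∀ {M M' H K i d dip} → Δ ⊢ M ─[ arrive H K (newpkt d dip) ]→ᴹ M' → H ≐ ｛ i ｝ →
            Δ ⊢ [ M ] ─[ newpktN i d dip ]→ᶜ [ M' ]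
    cpass : ∀ {M M' a} → Interleave a → Δ ⊢ M ─[ a ]→ᴹ M' → Δ ⊢ [ M ] ─[ a ]→ᶜ [ M' ]

  _⊢_─[_]→ᶜ- : Spec → CNet → NAct → Set₁
  Δ ⊢ N ─[ a ]→ᶜ- = ∃ λ N' → Δ ⊢ N ─[ a ]→ᶜ N'

  AllNodes : (Node → Set₁) → Net → Set₁
  AllNodes Q (node n) = Q n
  AllNodes Q (M ∥ N) = AllNodes Q M × AllNodes Q N

  InputEnabled : Spec → Node → Set₁
  InputEnabled Δ (i ∶ P ∶ R) = ∀ (m : MSG) → ∃ λ P' → Δ ⊢ P ─[ receiveA m ]→ᴾ P'

  NodeNoCastInSum : Node → Set₁
  NodeNoCastInSum (i ∶ P ∶ R) = Lift _ (AllSeq NoCastInSum P)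

-- The argument climbs the four syntactic levels.  A wait action records
-- whether the process waits while ready to receive (wr), to send (ws), or
-- both (wrs); the key observation is that a wait step labelled with r (s)
-- implies the process can actually receive every message (send some
-- message).  With this "capability" lemma in hand:
--  * every sequential process can make a time step (a plain wait or a
--    transmission wait for any range R) or a visible step (τ, *cast or
--    deliver); guardedness makes unfolding a process name terminate;
--  * for P ⟪ Q, two time steps combine unless P waits to receive while Q
--    waits to send -- but then the capability lemma yields a τ handshake;
--  * a node turns these into tick, τ, *cast or deliver, and a *cast of one
--    component is always absorbed by the input-enabled rest of the network;
--  * finally [·] turns the remaining *cast into τ.

module Submission where

open import Defs
open import Level using (0ℓ)
open import Axiom.ExcludedMiddle using (ExcludedMiddle)
open import Data.Product using (∃; ∃₂; _×_; _,_; proj₁; proj₂)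
open import Data.Sum using (_⊎_; inj₁; inj₂; [_,_]′)
open import Data.Maybe using (Maybe; just; nothing)
open import Data.Nat using (zero; suc)
open import Data.Unit using (tt)
open import Relation.Nullary using (yes; no)
open import Relation.Binary.PropositionalEquality using (_≡_; refl; subst)
open import Relation.Unary using (_⊆_; _∩_; Empty; Satisfiable)

module NetworkProgress (S : Signature) (Δ : Semantics.Spec S) where
  open Semantics S

  data Receives : W → Set where
    wr  : Receives wr
    wrs : Receives wrs

  data Sends : W → Set where
    ws  : Sends ws
    wrs : Sends wrs

  ∧-receives : ∀ {w₁ w₂} → Receives (w₁ ∧ʷ w₂) → Receives w₁ ⊎ Receives w₂
  ∧-receives {w}             r   = inj₂ r
  ∧-receives {wr}            _   = inj₁ wr
  ∧-receives {wrs}           _   = inj₁ wrs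
  ∧-receives {ws}  {wr}      _   = inj₂ wr
  ∧-receives {ws}  {wrs}     _   = inj₂ wrs
  ∧-receives {ws}  {w}       ()
  ∧-receives {ws}  {ws}      ()

  ∧-sends : ∀ {w₁ w₂} → Sends (w₁ ∧ʷ w₂) → Sends w₁ ⊎ Sends w₂
  ∧-sends {w}             s   = inj₂ s
  ∧-sends {ws}            _   = inj₁ ws
  ∧-sends {wrs}           _   = inj₁ wrs
  ∧-sends {wr}  {ws}      _   = inj₂ ws
  ∧-sends {wr}  {wrs}     _   = inj₂ wrs
  ∧-sends {wr}  {w}       ()
  ∧-sends {wr}  {wr}      ()

  ParallelWait : W → W → Maybe W → Set
  ParallelWait w₁ w₂ nothing   = Receives w₁ × Sends w₂
  ParallelWait w₁ w₂ (just w₃) = (Receives w₃ → Receives w₂) × (Sends w₃ → Sends w₁)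

  parallelWait : ∀ w₁ w₂ → ParallelWait w₁ w₂ (w₁ ⟪ʷ w₂)
  parallelWait w   w   = (λ ()) , (λ ())
  parallelWait w   wr  = (λ _ → wr) , (λ ())
  parallelWait w   ws  = (λ ()) , (λ ())
  parallelWait w   wrs = (λ _ → wrs) , (λ ())
  parallelWait wr  w   = (λ ()) , (λ ())
  parallelWait wr  wr  = (λ _ → wr) , (λ ())
  parallelWait wr  ws  = wr , ws
  parallelWait wr  wrs = wr , wrs
  parallelWait ws  w   = (λ ()) , (λ _ → ws)
  parallelWait ws  wr  = (λ _ → wr) , (λ _ → ws)
  parallelWait ws  ws  = (λ ()) , (λ _ → ws)
  parallelWait ws  wrs = (λ _ → wrs) , (λ _ → ws)
  parallelWait wrs w   = (λ ()) , (λ _ → wrs)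
  parallelWait wrs wr  = (λ _ → wr) , (λ _ → wrs)
  parallelWait wrs ws  = wrs , ws
  parallelWait wrs wrs = wrs , wrs

  definedParallelWait : ∀ {w₁ w₂ w₃} → w₁ ⟪ʷ w₂ ≡ just w₃ → ParallelWait w₁ w₂ (just w₃)
  definedParallelWait {w₁} {w₂} eq = subst (ParallelWait w₁ w₂) eq (parallelWait w₁ w₂)

  SeqStep : Valuation → SP → Act → Valuation × SP → Set₁
  SeqStep ξ p a t = Δ ⊢ ξ , p ─[ a ]→ proj₁ t , proj₂ t

  ParStep : PP → Act → PP → Set₁
  ParStep P a P' = Δ ⊢ P ─[ a ]→ᴾ P'

  record Capable {T : Set₁} (Step : Act → T → Set₁) (w₁ : W) : Set₁ where
    field
      receiving : Receives w₁ → ∀ m → ∃ (Step (receiveA m))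
      sending   : Sends w₁ → ∃₂ λ m t → Step (sendA m) t
  open Capable

  inert : ∀ {T : Set₁} {Step : Act → T → Set₁} → Capable Step w
  inert = record { receiving = λ () ; sending = λ () }

  transfer : ∀ {T T' : Set₁} {Step : Act → T → Set₁} {Step' : Act → T' → Set₁} {w₁}
             (f : T → T') → (∀ {a t} → NonWait a → Step a t → Step' a (f t)) →
             Capable Step w₁ → Capable Step' w₁
  transfer f lift c = record
    { receiving = λ r m → let (t , s) = receiving c r m in f t , lift (receiveA m) s
    ; sending   = λ r → let (m , t , s) = sending c r in m , f t , lift (sendA m) s
    }

  joinCapable : ∀ {T : Set₁} {Step : Act → T → Set₁} {w₁ w₂} →
                Capable Step w₁ → Capable Step w₂ → Capable Step (w₁ ∧ʷ w₂)
  joinCapable {w₁ = w₁} {w₂} c₁ c₂ = record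
    { receiving = λ r → [ receiving c₁ , receiving c₂ ]′ (∧-receives {w₁} {w₂} r)
    ; sending   = λ s → [ sending c₁ , sending c₂ ]′ (∧-sends {w₁} {w₂} s)
    }

  parallelCapable : ∀ {P Q w₁ w₂ w₃} → w₁ ⟪ʷ w₂ ≡ just w₃ →
                    Capable (ParStep P) w₁ → Capable (ParStep Q) w₂ → Capable (ParStep (P ⟪ Q)) w₃
  parallelCapable eq cP cQ = record
    { receiving = λ r m → let (_ , s) = receiving cQ (toRight r) m in _ , right (receiveA m) s
    ; sending   = λ r → let (m , _ , s) = sending cP (toLeft r) in m , _ , left (sendA m) s
    }
    where
      toRight = proj₁ (definedParallelWait eq)
      toLeft  = proj₂ (definedParallelWait eq)

  rangedWaitIsPlain : ∀ {ξ p R w₁ ζ q} → Δ ⊢ ξ , p ─[ rwait R w₁ ]→ ζ , q → w₁ ≡ w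
  rangedWaitIsPlain (cw₁ _)       = refl
  rangedWaitIsPlain (cw₂ _)       = refl
  rangedWaitIsPlain (callA _ _ s) = rangedWaitIsPlain s
  rangedWaitIsPlain (sumL _ s)    = rangedWaitIsPlain s
  rangedWaitIsPlain (sumR _ s)    = rangedWaitIsPlain s

  -- The capability lemma for sequential processes.  The remaining wait
  -- rules (undefined arguments, failing guards) are labelled w.
  capableˢ : ∀ {ξ p w₁ ζ q} → Δ ⊢ ξ , p ─[ wait w₁ ]→ ζ , q → Capable (SeqStep ξ p) w₁
  capableˢ (sndw eq)      = record { receiving = λ () ; sending = λ _ → _ , _ , snd eq }
  capableˢ rcvw           = record { receiving = λ _ m → _ , rcv m ; sending = λ () }
  capableˢ (callW eq s)   = transfer (λ t → t) (callA eq) (capableˢ s)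
  capableˢ (sumW s₁ s₂)   = joinCapable (transfer (λ t → t) sumL (capableˢ s₁))
                                        (transfer (λ t → t) sumR (capableˢ s₂))
  capableˢ (callA _ () _)
  capableˢ (sumL () _)
  capableˢ (sumR () _)
  capableˢ {w₁ = w} _     = inert

  data TimeLabel (R : IPSet) (w₁ : W) : Act → Set₁ where
    plain  : TimeLabel R w₁ (wait w₁)
    ranged : TimeLabel R w₁ (rwait R w₁)

  capableᴾ : ∀ {R w₁ a P P'} → TimeLabel R w₁ a → Δ ⊢ P ─[ a ]→ᴾ P' → Capable (ParStep P) w₁
  capableᴾ plain  (seq s) = transfer (λ (ζ , q) → ⟨ ζ , q ⟩) (λ _ → seq) (capableˢ s)
  capableᴾ ranged (seq s) with rangedWaitIsPlain s
  ... | refl = inert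
  capableᴾ {R} plain  (tWW sP sQ eq) =
    parallelCapable eq (capableᴾ (plain {R}) sP) (capableᴾ (plain {R}) sQ)
  capableᴾ {R} ranged (tRW sP sQ eq) =
    parallelCapable eq (capableᴾ ranged sP) (capableᴾ (plain {R}) sQ)
  capableᴾ {R} ranged (tWR sP sQ eq) =
    parallelCapable eq (capableᴾ (plain {R}) sP) (capableᴾ ranged sQ)
  capableᴾ ranged (tRR sP sQ eq) =
    parallelCapable eq (capableᴾ ranged sP) (capableᴾ ranged sQ)
  capableᴾ plain  (left () _)
  capableᴾ plain  (right () _)
  capableᴾ ranged (left () _)
  capableᴾ ranged (right () _)

  data Visible : Act → Set₁ where
    τ        : Visible τ
    cast     : ∀ D m → Visible (cast D m)
    deliverA : ∀ d → Visible (deliverA d)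

  visibleNonWait : ∀ {a} → Visible a → NonWait a
  visibleNonWait τ            = τ
  visibleNonWait (cast D m)   = cast D m
  visibleNonWait (deliverA d) = deliverA d

  visibleLeft : ∀ {a} → Visible a → LeftPass a
  visibleLeft τ            = τ
  visibleLeft (cast D m)   = cast D m
  visibleLeft (deliverA d) = deliverA d

  visibleRight : ∀ {a} → Visible a → RightPass a
  visibleRight τ            = τ
  visibleRight (cast D m)   = cast D m
  visibleRight (deliverA d) = deliverA d

  data Progress {T : Set₁} (R : IPSet) (Step : Act → T → Set₁) : Set₁ where
    time    : ∀ {w₁ a t} → TimeLabel R w₁ a → Step a t → Progress R Step
    visible : ∀ {a t} → Visible a → Step a t → Progress R Step

  -- Progress of a choice: a time step needs both summands to wait, unless
  -- one of them is already waiting for a transmission.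
  sumProgress : ∀ {R ξ p q} → Progress R (SeqStep ξ p) → Progress R (SeqStep ξ q) →
                Progress R (SeqStep ξ (p ⊕ q))
  sumProgress (visible v s)   _               = visible v (sumL (visibleNonWait v) s)
  sumProgress (time ranged s) _               = time ranged (sumL (rwait _ _) s)
  sumProgress (time plain _)  (visible v s)   = visible v (sumR (visibleNonWait v) s)
  sumProgress (time plain _)  (time ranged s) = time ranged (sumR (rwait _ _) s)
  sumProgress (time plain s₁) (time plain s₂) = time plain (sumW s₁ s₂)

  module _ (em : ExcludedMiddle 0ℓ) (R : IPSet) where

    progressᴳ : ∀ p → Guarded p → ∀ ξ → Progress R (SeqStep ξ p)
    progressᴳ (call X es) () ξ
    progressᴳ (p ⊕ q) (gp , gq) ξ = sumProgress (progressᴳ p gp ξ) (progressᴳ q gq ξ)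
    progressᴳ (guard φ p) _ ξ with em {∃ λ ζ → Extends ξ φ ζ × ζ ⊨ φ}
    ... | yes (ζ , ext , sat) = visible τ (grd ζ ext sat)
    ... | no unsat            = time plain (grdW unsat)
    progressᴳ (assign x e p) _ ξ with evalE e ξ in eq
    ... | just _  = visible τ (asg eq)
    ... | nothing = time plain (asgU eq)
    progressᴳ (broadcast ms p) _ ξ with evalMSG ms ξ in eq
    ... | just _  = visible τ (bc eq)
    ... | nothing = time plain (bcU eq)
    progressᴳ (groupcast ds ms p) _ ξ with evalIPSet ds ξ in eq₁ | evalMSG ms ξ in eq₂
    ... | just _  | just _  = visible τ (gc eq₁ eq₂)
    ... | nothing | _       = time plain (gcU₁ eq₁)
    ... | just _  | nothing = time plain (gcU₂ eq₂)
    progressᴳ (unicast d ms p q) _ ξ with evalIP d ξ in eq₁ | evalMSG ms ξ in eq₂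
    ... | just _  | just _  = visible τ (uc eq₁ eq₂)
    ... | nothing | _       = time plain (ucU₁ eq₁)
    ... | just _  | nothing = time plain (ucU₂ eq₂)
    progressᴳ (send ms p) _ ξ with evalMSG ms ξ in eq
    ... | just _  = time plain (sndw eq)
    ... | nothing = time plain (sndU eq)
    progressᴳ (deliver e p) _ ξ with evalDATA e ξ in eq
    ... | just d  = visible (deliverA d) (dlv eq)
    ... | nothing = time plain (dlvU eq)
    progressᴳ (receive x p) _ ξ = time plain rcvw
    progressᴳ (*cast D m (suc n) o p q) _ ξ = time ranged (cw₁ R)
    progressᴳ (*cast D m zero o p q) _ ξ with em {Satisfiable D}
    ... | yes someone = visible (cast D m) (cok someone)
    ... | no nobody   = visible τ (cno λ x x∈D → nobody (x , x∈D))

    module _ (wf : WellFormedSpec Δ) where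

      callProgress : ∀ X es ξ → Progress R (SeqStep ξ (call X es))
      callProgress X es ξ with evalArgs es ξ in eq
      ... | nothing = time plain (callU eq)
      ... | just vs with progressᴳ (Spec.body Δ X) (proj₁ (wf X)) (bind (Spec.params Δ X) vs)
      ...   | time plain s  = time plain (callW eq s)
      ...   | time ranged s = time ranged (callA eq (rwait _ _) s)
      ...   | visible v s   = visible v (callA eq (visibleNonWait v) s)

      -- Every sequential process makes progress; apart from calls and
      -- choices, expressions are guarded and handled by progressᴳ.
      progressˢ : ∀ p ξ → Progress R (SeqStep ξ p)
      progressˢ (call X es) ξ = callProgress X es ξ
      progressˢ (p ⊕ q) ξ = sumProgress (progressˢ p ξ) (progressˢ q ξ)
      progressˢ p@(guard _ _)         = progressᴳ p tt
      progressˢ p@(assign _ _ _)      = progressᴳ p tt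
      progressˢ p@(broadcast _ _)     = progressᴳ p tt
      progressˢ p@(groupcast _ _ _)   = progressᴳ p tt
      progressˢ p@(unicast _ _ _ _)   = progressᴳ p tt
      progressˢ p@(send _ _)          = progressᴳ p tt
      progressˢ p@(deliver _ _)       = progressᴳ p tt
      progressˢ p@(receive _ _)       = progressᴳ p tt
      progressˢ p@(*cast _ _ _ _ _ _) = progressᴳ p tt

  synchronisedTime : ∀ {R w₁ w₂ w₃ a b P P' Q Q'} →
                     TimeLabel R w₁ a → Δ ⊢ P ─[ a ]→ᴾ P' →
                     TimeLabel R w₂ b → Δ ⊢ Q ─[ b ]→ᴾ Q' →
                     w₁ ⟪ʷ w₂ ≡ just w₃ → Progress R (ParStep (P ⟪ Q))
  synchronisedTime plain  sP plain  sQ eq = time plain  (tWW sP sQ eq)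
  synchronisedTime ranged sP plain  sQ eq = time ranged (tRW sP sQ eq)
  synchronisedTime plain  sP ranged sQ eq = time ranged (tWR sP sQ eq)
  synchronisedTime ranged sP ranged sQ eq = time ranged (tRR sP sQ eq)

  -- Progress of P ⟪ Q: a visible step of either side passes through; two
  -- time steps either compose or, if P waits to receive while Q waits to
  -- send, the capability lemma provides a τ handshake.
  parallelProgress : ∀ {R P Q} → Progress R (ParStep P) → Progress R (ParStep Q) →
                     Progress R (ParStep (P ⟪ Q))
  parallelProgress (visible v s) _             = visible v (left (visibleLeft v) s)
  parallelProgress (time _ _)    (visible v s) = visible v (right (visibleRight v) s)
  parallelProgress (time {w₁} l₁ s₁) (time {w₂} l₂ s₂)
    with w₁ ⟪ʷ w₂ in eq | parallelWait w₁ w₂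
  ... | just _  | _                 = synchronisedTime l₁ s₁ l₂ s₂ eq
  ... | nothing | (receives , sends) =
    let (m , _ , sendStep) = sending (capableᴾ l₂ s₂) sends
        (_ , receiveStep)  = receiving (capableᴾ l₁ s₁) receives m
    in visible τ (comm receiveStep sendStep)

  progressᴾ : ExcludedMiddle 0ℓ → WellFormedSpec Δ → ∀ R P → Progress R (ParStep P)
  progressᴾ em wf R ⟨ ξ , p ⟩ with progressˢ em R wf p ξ
  ... | time l s    = time l (seq s)
  ... | visible v s = visible v (seq s)
  progressᴾ em wf R (P ⟪ Q) = parallelProgress (progressᴾ em wf R P) (progressᴾ em wf R Q)

  data Spontaneous : NAct → Set₁ where
    deliverN : ∀ i d → Spontaneous (deliverN i d)
    τ        : Spontaneous τ

  spontaneousInterleaves : ∀ {a} → Spontaneous a → Interleave a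
  spontaneousInterleaves (deliverN i d) = deliverN i d
  spontaneousInterleaves τ              = τ

  data NetProgress (M : Net) : Set₁ where
    tick        : ∀ {M'} → Δ ⊢ M ─[ tick ]→ᴹ M' → NetProgress M
    spontaneous : ∀ {a M'} → Spontaneous a → Δ ⊢ M ─[ a ]→ᴹ M' → NetProgress M
    cast        : ∀ {R m M'} → Δ ⊢ M ─[ cast R m ]→ᴹ M' → NetProgress M

  nodeProgress : ∀ {i P R} → Progress R (ParStep P) → NetProgress (node (i ∶ P ∶ R))
  nodeProgress     (time plain s)            = tick (mnode (ntickW s))
  nodeProgress     (time ranged s)           = tick (mnode (ntickR s))
  nodeProgress     (visible τ s)             = spontaneous τ (mnode (nτ s))
  nodeProgress     (visible (cast D m) s)    = cast (mnode (ncast s))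
  nodeProgress {i} (visible (deliverA d) s) = spontaneous (deliverN i d) (mnode (ndlv s))

  data Absorbs (R : IPSet) (m : MSG) (M : Net) : Set₁ where
    absorbs : ∀ {H K M'} → H ⊆ R → Empty (K ∩ R) → Δ ⊢ M ─[ arrive H K m ]→ᴹ M' → Absorbs R m M

  -- An input-enabled network absorbs every cast: a node inside R receives,
  -- a node outside R ignores the message.
  absorb : ExcludedMiddle 0ℓ → ∀ M → AllNodes (InputEnabled Δ) M → ∀ R m → Absorbs R m M
  absorb em (node (i ∶ P ∶ _)) enabled R m with em {R i}
  ... | yes i∈R = absorbs (λ { refl → i∈R }) (λ _ ()) (mnode (nrecv (proj₂ (enabled m))))
  ... | no  i∉R = absorbs (λ ()) (λ { _ (refl , i∈R) → i∉R i∈R }) (mnode (nnot m))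
  absorb em (M ∥ N) (enabledM , enabledN) R m
    with absorb em M enabledM R m | absorb em N enabledN R m
  ... | absorbs H⊆R K∩R=∅ sM | absorbs H'⊆R K'∩R=∅ sN =
    absorbs (λ { (inj₁ h) → H⊆R h ; (inj₂ h) → H'⊆R h })
            (λ { x (inj₁ k , r) → K∩R=∅ x (k , r) ; x (inj₂ k , r) → K'∩R=∅ x (k , r) })
            (arr sM sN)

  composedProgress : ∀ {M N} → (∀ R m → Absorbs R m M) → (∀ R m → Absorbs R m N) →
                     NetProgress M → NetProgress N → NetProgress (M ∥ N)
  composedProgress _ _ (spontaneous a s) _ = spontaneous a (intL (spontaneousInterleaves a) s)
  composedProgress _ absorbN (cast {R} {m} s) _ with absorbN R m
  ... | absorbs H⊆R K∩R=∅ sN = cast (castL s sN H⊆R K∩R=∅)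
  composedProgress _ _ (tick _) (spontaneous a s) = spontaneous a (intR (spontaneousInterleaves a) s)
  composedProgress absorbM _ (tick _) (cast {R} {m} s) with absorbM R m
  ... | absorbs H⊆R K∩R=∅ sM = cast (castR sM s H⊆R K∩R=∅)
  composedProgress _ _ (tick sM) (tick sN) = tick (tck sM sN)

  netProgress : ExcludedMiddle 0ℓ → WellFormedSpec Δ →
                ∀ M → AllNodes (InputEnabled Δ) M → NetProgress M
  netProgress em wf (node (i ∶ P ∶ R)) _ = nodeProgress (progressᴾ em wf R P)
  netProgress em wf (M ∥ N) (enabledM , enabledN) =
    composedProgress (absorb em M enabledM) (absorb em N enabledN)
                     (netProgress em wf M enabledM) (netProgress em wf N enabledN)

  completeProgress : ∀ {M} → NetProgress M →
                     (Δ ⊢ [ M ] ─[ tick ]→ᶜ-)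
                     ⊎ (∃₂ λ (ip : IP) (d : DATA) → Δ ⊢ [ M ] ─[ deliverN ip d ]→ᶜ-)
                     ⊎ (Δ ⊢ [ M ] ─[ τ ]→ᶜ-)
  completeProgress (tick s)                       = inj₁ (_ , ctick s)
  completeProgress (spontaneous (deliverN i d) s) = inj₂ (inj₁ (i , d , _ , cpass (deliverN i d) s))
  completeProgress (spontaneous τ s)              = inj₂ (inj₂ (_ , cpass τ s))
  completeProgress (cast s)                       = inj₂ (inj₂ (_ , ccast s))

-- The argument does not use the hypothesis that *cast
-- avoids +-contexts (neither for the nodes nor for the specification).
corollary2 : (S : Signature) → let open Semantics S in
    ExcludedMiddle 0ℓ →
    (Δ : Spec) → WellFormedSpec Δ →
    (M : Net) → AllNodes (InputEnabled Δ) M → AllNodes NodeNoCastInSum M →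
    (Δ ⊢ [ M ] ─[ tick ]→ᶜ-)
    ⊎ (∃₂ λ (ip : IP) (d : DATA) → Δ ⊢ [ M ] ─[ deliverN ip d ]→ᶜ-)
    ⊎ (Δ ⊢ [ M ] ─[ τ ]→ᶜ-)
corollary2 S em Δ wf M enabled _ = completeProgress (netProgress em wf M enabled)
  where open NetworkProgress S Δ
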